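{- For $n\ge0$, let $a_n$ be the number of $2\times n$ Nurikabe grids. Then $a_n=6\cdot 2^n-3n-5$ for all $n\ge 0$.
   Context: A $2\times n$ Nurikabe grid is a coloring of the cells of a $2\times n$ grid with black and white such that (1) the set of black cells is edge-connected (it forms a polyomino; the empty set of black cells is allowed) and (2) no $2\times2$ subgrid consists entirely of black cells. For $n=0$ there is exactly one (empty) grid. -}

module Defs where

open import Data.Nat using (ℕ; suc)
open import Data.Bool using (Bool; true)
open import Data.Fin using (Fin; toℕ)
open import Data.Vec using (Vec; lookup)
open import Data.Product using (_×_; _,_)
open import Relation.Binary.PropositionalEquality using (_≡_; _≢_)
open import Relation.Nullary using (¬_)

-- A 2×n grid: two rows of length n; true = black, false = white.
Grid : ℕ → Set
Grid n = Vec (Vec Bool n) 2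

Cell : ℕ → Set
Cell n = Fin 2 × Fin n

Black : ∀ {n} → Grid n → Cell n → Set
Black g (r , i) = lookup (lookup g r) i ≡ true

data Adj {n : ℕ} : Cell n → Cell n → Set where
  right : ∀ r (i j : Fin n) → suc (toℕ i) ≡ toℕ j → Adj (r , i) (r , j)
  left  : ∀ r (i j : Fin n) → toℕ i ≡ suc (toℕ j) → Adj (r , i) (r , j)
  vert  : ∀ (r r' : Fin 2) i → r ≢ r' → Adj (r , i) (r' , i)

data BlackPath {n : ℕ} (g : Grid n) : Cell n → Cell n → Set where
  stop : ∀ {c} → Black g c → BlackPath g c c
  step : ∀ {c c' d} → Black g c → Adj c c' → BlackPath g c' d → BlackPath g c d

BlackConnected : ∀ {n} → Grid n → Set
BlackConnected {n} g = ∀ (c d : Cell n) → Black g c → Black g d → BlackPath g c d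

No2x2 : ∀ {n} → Grid n → Set
No2x2 {n} g = ∀ (i j : Fin n) → suc (toℕ i) ≡ toℕ j →
  ¬ (Black g (Fin.zero , i) × Black g (Fin.zero , j) ×
     Black g (Fin.suc Fin.zero , i) × Black g (Fin.suc Fin.zero , j))

Nurikabe : ∀ {n} → Grid n → Set
Nurikabe g = BlackConnected g × No2x2 g

-- Read a grid column by column. A Nurikabe grid is either a blank column followed by a Nurikabe
-- grid, or a non-blank column followed by a tail that is compatible with it. The tail of a
-- non-blank column is either entirely blank (the black region ended) or starts with a column that
-- shares a black row with it (otherwise the black cells of the first column are cut off from the
-- rest) without both columns being full (a 2×2 block). Every non-blank column has exactly two
-- compatible successors, so the number t(n) of admissible tails of width n satisfies
-- t(n+1) = 1 + 2 t(n), t(0) = 1, i.e. t(n) = 2^(n+1) − 1, and the number of Nurikabe grids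
-- satisfies a(n+1) = a(n) + 3 t(n), which sums to 6·2^n − 3n − 5.
module Submission where

open import Defs
open import Data.Nat using (ℕ; zero; suc; _+_; _*_; _∸_; _^_)
open import Data.Nat.Properties using (suc-injective; *-suc; m+n∸n≡m)
open import Data.Nat.Tactic.RingSolver using (solve-∀)
open import Data.Bool using (Bool; true; false)
open import Data.Fin using (Fin; toℕ; _≟_) renaming (suc to fsuc)
open import Data.Fin.Patterns using (0F; 1F)
open import Data.Vec using (Vec; []; _∷_; lookup; replicate)
open import Data.Vec.Properties using (lookup-replicate)
open import Data.List using (List; []; _∷_; _++_; map; length)
open import Data.List.Properties using (length-++; length-map)
open import Data.List.Membership.Propositional using (_∈_)
open import Data.List.Membership.Propositional.Properties
  using (∈-map⁺; ∈-map⁻; ∈-++⁺ˡ; ∈-++⁺ʳ; ∈-++⁻)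
open import Data.List.Relation.Unary.Any using (here; there)
open import Data.List.Relation.Unary.All as All using (All; []; _∷_)
import Data.List.Relation.Unary.All.Properties as All
open import Data.List.Relation.Unary.AllPairs using ([]; _∷_)
open import Data.List.Relation.Unary.Unique.Propositional using (Unique)
import Data.List.Relation.Unary.Unique.Propositional.Properties as Unique
open import Data.Product using (Σ; ∃-syntax; _×_; _,_)
open import Data.Sum using (_⊎_; inj₁; inj₂)
open import Data.Empty using (⊥-elim)
open import Relation.Nullary using (¬_; yes; no)
open import Relation.Binary.PropositionalEquality

module _ {n} {g : Grid n} where

  head-black : ∀ {x y} → BlackPath g x y → Black g x
  head-black (stop b) = b
  head-black (step b _ _) = b

  path-trans : ∀ {x y z} → BlackPath g x y → BlackPath g y z → BlackPath g x z
  path-trans (stop _) q = q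
  path-trans (step b a p) q = step b a (path-trans p q)

  Adj-sym : ∀ {x y : Cell n} → Adj x y → Adj y x
  Adj-sym (right r i j eq) = left r j i (sym eq)
  Adj-sym (left r i j eq) = right r j i (sym eq)
  Adj-sym (vert r r' i r≢r') = vert r' r i (λ eq → r≢r' (sym eq))

  path-sym : ∀ {x y} → BlackPath g x y → BlackPath g y x
  path-sym (stop b) = stop b
  path-sym (step b a p) = path-trans (path-sym p) (step (head-black p) (Adj-sym a) (stop b))

  path-vertical : ∀ {r r' i} → Black g (r , i) → Black g (r' , i) → BlackPath g (r , i) (r' , i)
  path-vertical {r} {r'} {i} b b' with r ≟ r'
  ... | yes refl = stop b
  ... | no r≢r' = step b (vert r r' i r≢r') (stop b')

Column : Set
Column = Bool × Bool

blank : Column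
blank = false , false

infixr 5 _◂_
_◂_ : ∀ {n} → Column → Grid n → Grid (suc n)
(a , b) ◂ g = (a ∷ lookup g 0F) ∷ (b ∷ lookup g 1F) ∷ []

firstColumn : ∀ {n} → Grid (suc n) → Column
firstColumn g = lookup (lookup g 0F) 0F , lookup (lookup g 1F) 0F

◂-injective : ∀ {n c} {g g' : Grid n} → c ◂ g ≡ c ◂ g' → g ≡ g'
◂-injective {g = _ ∷ _ ∷ []} {_ ∷ _ ∷ []} refl = refl

blankGrid : ∀ n → Grid n
blankGrid n = replicate 2 (replicate n false)

blankGrid-white : ∀ {n} r (i : Fin n) → ¬ Black (blankGrid n) (r , i)
blankGrid-white 0F i b with () ← trans (sym (lookup-replicate i false)) b
blankGrid-white 1F i b with () ← trans (sym (lookup-replicate i false)) b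

blankGrid-or-black : ∀ {n} (g : Grid n) → g ≡ blankGrid n ⊎ ∃[ x ] Black g x
blankGrid-or-black (xs ∷ ys ∷ []) with row xs | row ys
  where
  row : ∀ {n} (xs : Vec Bool n) → xs ≡ replicate n false ⊎ ∃[ i ] lookup xs i ≡ true
  row [] = inj₁ refl
  row (true ∷ xs) = inj₂ (0F , refl)
  row (false ∷ xs) with row xs
  ... | inj₁ eq = inj₁ (cong (false ∷_) eq)
  ... | inj₂ (i , b) = inj₂ (fsuc i , b)
... | inj₁ refl | inj₁ refl = inj₁ refl
... | inj₂ (i , b) | _ = inj₂ ((0F , i) , b)
... | inj₁ _ | inj₂ (i , b) = inj₂ ((1F , i) , b)

data Shade : Set where
  top bottom full : Shade

column : Shade → Column
column top = true , false
column bottom = false , true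
column full = true , true

column-injective : ∀ {s s'} → column s ≡ column s' → s ≡ s'
column-injective {top} {top} _ = refl
column-injective {bottom} {bottom} _ = refl
column-injective {full} {full} _ = refl
column-injective {top} {bottom} ()
column-injective {top} {full} ()
column-injective {bottom} {top} ()
column-injective {bottom} {full} ()
column-injective {full} {top} ()
column-injective {full} {bottom} ()

column≢blank : ∀ s → column s ≢ blank
column≢blank top ()
column≢blank bottom ()
column≢blank full ()

column-black : ∀ {n} s {g : Grid n} → ∃[ r ] Black (column s ◂ g) (r , 0F)
column-black top = 0F , refl
column-black bottom = 1F , refl
column-black full = 0F , refl

data FirstColumnView {n} : Grid (suc n) → Set where
  blank◂ : ∀ g → FirstColumnView (blank ◂ g)
  shaded◂ : ∀ s g → FirstColumnView (column s ◂ g)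

firstColumnView : ∀ {n} (g : Grid (suc n)) → FirstColumnView g
firstColumnView ((false ∷ xs) ∷ (false ∷ ys) ∷ []) = blank◂ (xs ∷ ys ∷ [])
firstColumnView ((true ∷ xs) ∷ (false ∷ ys) ∷ []) = shaded◂ top (xs ∷ ys ∷ [])
firstColumnView ((false ∷ xs) ∷ (true ∷ ys) ∷ []) = shaded◂ bottom (xs ∷ ys ∷ [])
firstColumnView ((true ∷ xs) ∷ (true ∷ ys) ∷ []) = shaded◂ full (xs ∷ ys ∷ [])

shift : ∀ {n} → Cell n → Cell (suc n)
shift (r , i) = r , fsuc i

Adj-shift : ∀ {n} {x y : Cell n} → Adj x y → Adj (shift x) (shift y)
Adj-shift (right r i j eq) = right r (fsuc i) (fsuc j) (cong suc eq)
Adj-shift (left r i j eq) = left r (fsuc i) (fsuc j) (cong suc eq)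
Adj-shift (vert r r' i r≢r') = vert r r' (fsuc i) r≢r'

Adj-unshift : ∀ {n r r'} {i j : Fin n} → Adj (r , fsuc i) (r' , fsuc j) → Adj (r , i) (r' , j)
Adj-unshift (right r _ _ eq) = right r _ _ (suc-injective eq)
Adj-unshift (left r _ _ eq) = left r _ _ (suc-injective eq)
Adj-unshift (vert r r' _ r≢r') = vert r r' _ r≢r'

Adj-leaving-first : ∀ {n r r'} {j : Fin (suc n)} → Adj (r , 0F) (r' , fsuc j) → j ≡ 0F
Adj-leaving-first {j = 0F} _ = refl
Adj-leaving-first {j = fsuc _} (right _ _ _ ())

Adj-entering-first : ∀ {n r r'} {i : Fin (suc n)} → Adj (r , fsuc i) (r' , 0F) → i ≡ 0F
Adj-entering-first {i = 0F} _ = refl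
Adj-entering-first {i = fsuc _} (left _ _ _ ())

Square : ∀ {n} → Grid n → Fin n → Fin n → Set
Square g i j = Black g (0F , i) × Black g (0F , j) × Black g (1F , i) × Black g (1F , j)

module _ {n} {c : Column} {g : Grid n} where

  black-shift : ∀ r {i} → Black g (r , i) → Black (c ◂ g) (r , fsuc i)
  black-shift 0F b = b
  black-shift 1F b = b

  black-unshift : ∀ r {i} → Black (c ◂ g) (r , fsuc i) → Black g (r , i)
  black-unshift 0F b = b
  black-unshift 1F b = b

  path-shift : ∀ {x y} → BlackPath g x y → BlackPath (c ◂ g) (shift x) (shift y)
  path-shift {r , _} (stop b) = stop (black-shift r b)
  path-shift {r , _} (step b a p) = step (black-shift r b) (Adj-shift a) (path-shift p)

  Nurikabe-◂⁺ : Nurikabe g →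
    (∀ {r r'} j → Black (c ◂ g) (r , 0F) → Black g (r' , j) →
       BlackPath (c ◂ g) (r , 0F) (r' , fsuc j)) →
    (∀ j → 1 ≡ toℕ j → ¬ Square (c ◂ g) 0F j) →
    Nurikabe (c ◂ g)
  Nurikabe-◂⁺ (conn , no2x2) bridge front = connected , no2x2′
    where
    connected : BlackConnected (c ◂ g)
    connected (r , 0F) (r' , 0F) b b' = path-vertical b b'
    connected (r , 0F) (r' , fsuc j) b b' = bridge j b (black-unshift r' b')
    connected (r , fsuc i) (r' , 0F) b b' = path-sym (bridge i b' (black-unshift r b))
    connected (r , fsuc i) (r' , fsuc j) b b' =
      path-shift (conn (r , i) (r' , j) (black-unshift r b) (black-unshift r' b'))

    no2x2′ : No2x2 (c ◂ g)
    no2x2′ 0F j eq = front j eq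
    no2x2′ (fsuc i) (fsuc j) eq = no2x2 i j (suc-injective eq)

-- A black path between two cells of the tail may detour through the first column, but it must
-- leave and re-enter it through the second column, where the two black cells are adjacent.
module _ {n} {c : Column} {g : Grid (suc n)} where

  mutual
    path-unshift : ∀ {r r' i j} → BlackPath (c ◂ g) (r , fsuc i) (r' , fsuc j) →
                   BlackPath g (r , i) (r' , j)
    path-unshift {r} (stop b) = stop (black-unshift {c = c} {g = g} r b)
    path-unshift {r} (step {c' = _ , 0F} b a p) with Adj-entering-first a
    ... | refl = path-reenter p (black-unshift {c = c} {g = g} r b)
    path-unshift {r} (step {c' = _ , fsuc _} b a p) =
      step (black-unshift {c = c} {g = g} r b) (Adj-unshift a) (path-unshift p)

    path-reenter : ∀ {r r₀ r' j} → BlackPath (c ◂ g) (r , 0F) (r' , fsuc j) →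
                   Black g (r₀ , 0F) → BlackPath g (r₀ , 0F) (r' , j)
    path-reenter (step {c' = _ , 0F} _ _ p) b₀ = path-reenter p b₀
    path-reenter (step {c' = r₁ , fsuc _} _ a p) b₀ with Adj-leaving-first a
    ... | refl =
      path-trans (path-vertical b₀ (black-unshift {c = c} {g = g} r₁ (head-black p))) (path-unshift p)

BlackConnected-◂⁻ : ∀ {n c} {g : Grid n} → BlackConnected (c ◂ g) → BlackConnected g
BlackConnected-◂⁻ {zero} _ (_ , ()) _
BlackConnected-◂⁻ {suc _} {c} {g} conn (r , i) (r' , j) b b' =
  path-unshift (conn (r , fsuc i) (r' , fsuc j)
    (black-shift {c = c} {g = g} r b) (black-shift {c = c} {g = g} r' b'))

Nurikabe-◂⁻ : ∀ {n c} {g : Grid n} → Nurikabe (c ◂ g) → Nurikabe g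
Nurikabe-◂⁻ {c = c} {g} (conn , no2x2) =
  BlackConnected-◂⁻ {c = c} {g} conn , λ i j i+1≡j → no2x2 (fsuc i) (fsuc j) (cong suc i+1≡j)

Nurikabe-blankGrid : ∀ {n} → Nurikabe (blankGrid n)
Nurikabe-blankGrid =
  (λ { (r , i) _ b _ → ⊥-elim (blankGrid-white r i b) }) , λ { i _ _ (b , _) → blankGrid-white 0F i b }

Nurikabe-◂blankGrid : ∀ {n} c → Nurikabe (c ◂ blankGrid n)
Nurikabe-◂blankGrid {n} c = Nurikabe-◂⁺ {c = c} {g = blankGrid n} Nurikabe-blankGrid
  (λ { {r' = r'} j _ b → ⊥-elim (blankGrid-white r' j b) })
  (λ { (fsuc j) _ (_ , b , _) → blankGrid-white 0F j b })

Nurikabe-blank◂ : ∀ {n} {g : Grid n} → Nurikabe g → Nurikabe (blank ◂ g)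
Nurikabe-blank◂ {g = g} nurikabe =
  Nurikabe-◂⁺ {c = blank} {g = g} nurikabe (λ { {0F} _ () ; {1F} _ () }) λ { _ _ (() , _) }

Nurikabe-glue : ∀ {n c} {g : Grid (suc n)} r → Black (c ◂ g) (r , 0F) → Black g (r , 0F) →
                ¬ Square (c ◂ g) 0F 1F → Nurikabe g → Nurikabe (c ◂ g)
Nurikabe-glue {c = c} {g} r b₀ b₁ no-front nurikabe@(conn , _) =
  Nurikabe-◂⁺ {c = c} {g = g} nurikabe bridge λ { (fsuc 0F) _ → no-front }
  where
  bridge : ∀ {r₁ r'} j → Black (c ◂ g) (r₁ , 0F) → Black g (r' , j) →
           BlackPath (c ◂ g) (r₁ , 0F) (r' , fsuc j)
  bridge {r' = r'} j b b' = path-trans (path-vertical b b₀)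
    (step b₀ (right r 0F 1F refl) (path-shift (conn (r , 0F) (r' , j) b₁ b')))

module _ {n} (g : Grid (suc (suc n))) (separated : ∀ r → Black g (r , 0F) → ¬ Black g (r , 1F)) where

  path-stays-first : ∀ {r r' j} → BlackPath g (r , 0F) (r' , j) → j ≡ 0F
  path-stays-first (stop _) = refl
  path-stays-first (step _ (vert _ _ _ _) p) = path-stays-first p
  path-stays-first (step b (right _ _ (fsuc 0F) _) p) = ⊥-elim (separated _ b (head-black p))
  path-stays-first (step _ (right _ _ (fsuc (fsuc _)) ()) _)

  separated-disconnected : BlackConnected g → ∀ {r r' j} → Black g (r , 0F) → ¬ Black g (r' , fsuc j)
  separated-disconnected conn b b' with () ← path-stays-first (conn _ _ b b')

successors : Shade → List Shade
successors top = top ∷ full ∷ []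
successors bottom = bottom ∷ full ∷ []
successors full = top ∷ bottom ∷ []

successors-unique : ∀ s → Unique (successors s)
successors-unique top = ((λ ()) ∷ []) ∷ [] ∷ []
successors-unique bottom = ((λ ()) ∷ []) ∷ [] ∷ []
successors-unique full = ((λ ()) ∷ []) ∷ [] ∷ []

length-successors : ∀ s → length (successors s) ≡ 2
length-successors top = refl
length-successors bottom = refl
length-successors full = refl

successor-sound : ∀ {n s s'} {g : Grid n} → s' ∈ successors s →
                  Nurikabe (column s' ◂ g) → Nurikabe (column s ◂ column s' ◂ g)
successor-sound {s = top} (here refl) = Nurikabe-glue 0F refl refl λ ()
successor-sound {s = top} (there (here refl)) = Nurikabe-glue 0F refl refl λ { (_ , _ , () , _) }
successor-sound {s = bottom} (here refl) = Nurikabe-glue 1F refl refl λ ()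
successor-sound {s = bottom} (there (here refl)) = Nurikabe-glue 1F refl refl λ { (() , _) }
successor-sound {s = full} (here refl) = Nurikabe-glue 0F refl refl λ { (_ , _ , _ , ()) }
successor-sound {s = full} (there (here refl)) = Nurikabe-glue 1F refl refl λ { (_ , () , _) }

successor-complete : ∀ {n} s s' {g : Grid n} →
                     Nurikabe (column s ◂ column s' ◂ g) → s' ∈ successors s
successor-complete top top _ = here refl
successor-complete top full _ = there (here refl)
successor-complete bottom bottom _ = here refl
successor-complete bottom full _ = there (here refl)
successor-complete full top _ = here refl
successor-complete full bottom _ = there (here refl)
successor-complete top bottom (conn , _) =
  ⊥-elim (separated-disconnected _ (λ { 0F _ () ; 1F () }) conn {0F} {1F} {0F} refl refl)
successor-complete bottom top (conn , _) =
  ⊥-elim (separated-disconnected _ (λ { 0F () ; 1F _ () }) conn {1F} {0F} {0F} refl refl)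
successor-complete full full (_ , no2x2) = ⊥-elim (no2x2 0F 1F refl (refl , refl , refl , refl))

blank-after-shade : ∀ {n s} {g : Grid n} →
                    Nurikabe (column s ◂ blank ◂ g) → blank ◂ g ≡ blankGrid (suc n)
blank-after-shade {s = s} {g} (conn , _) with blankGrid-or-black g
... | inj₁ refl = refl
... | inj₂ ((r , i) , b) =
  let r₀ , b₀ = column-black s {blank ◂ g} in
  ⊥-elim (separated-disconnected (column s ◂ blank ◂ g) (λ { 0F _ () ; 1F _ () }) conn {r₀} {r} b₀
    (black-shift {c = column s} {g = blank ◂ g} r (black-shift {c = blank} {g = g} r b)))

extensions : ∀ {n} → (Shade → List (Grid n)) → List Shade → List (Grid (suc n))
extensions L [] = []
extensions L (s ∷ ss) = map (column s ◂_) (L s) ++ extensions L ss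

firstColumn-map : ∀ {n c g} {gs : List (Grid n)} → g ∈ map (c ◂_) gs → firstColumn g ≡ c
firstColumn-map {c = c} g∈ with ∈-map⁻ (c ◂_) g∈
... | _ , _ , refl = refl

module _ {n} (L : Shade → List (Grid n)) where

  ∈-extensions⁺ : ∀ {s ss g} → s ∈ ss → g ∈ L s → column s ◂ g ∈ extensions L ss
  ∈-extensions⁺ {s} (here refl) g∈ = ∈-++⁺ˡ (∈-map⁺ (column s ◂_) g∈)
  ∈-extensions⁺ {ss = s' ∷ _} (there s∈) g∈ =
    ∈-++⁺ʳ (map (column s' ◂_) (L s')) (∈-extensions⁺ s∈ g∈)

  firstColumn-extensions : ∀ ss {g} → g ∈ extensions L ss →
                           ∃[ s ] s ∈ ss × firstColumn g ≡ column s
  firstColumn-extensions (s ∷ ss) g∈ with ∈-++⁻ (map (column s ◂_) (L s)) g∈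
  ... | inj₁ g∈ₗ = s , here refl , firstColumn-map g∈ₗ
  ... | inj₂ g∈ᵣ = let s' , s'∈ , eq = firstColumn-extensions ss g∈ᵣ in s' , there s'∈ , eq

  All-extensions⁺ : ∀ {P : Grid (suc n) → Set} ss →
    (∀ {s} → s ∈ ss → All (λ g → P (column s ◂ g)) (L s)) → All P (extensions L ss)
  All-extensions⁺ [] _ = []
  All-extensions⁺ (s ∷ ss) all =
    All.++⁺ (All.map⁺ (all (here refl))) (All-extensions⁺ ss (λ s∈ → all (there s∈)))

  extensions-unique : ∀ {ss} → Unique ss → (∀ s → Unique (L s)) → Unique (extensions L ss)
  extensions-unique {[]} _ _ = []
  extensions-unique {s ∷ ss} (s∉ss ∷ ss-unique) L-unique =
    Unique.++⁺ (Unique.map⁺ ◂-injective (L-unique s)) (extensions-unique ss-unique L-unique) disjoint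
    where
    disjoint : ∀ {g} → ¬ (g ∈ map (column s ◂_) (L s) × g ∈ extensions L ss)
    disjoint (g∈ₗ , g∈ᵣ) =
      let s' , s'∈ , eq = firstColumn-extensions ss g∈ᵣ in
      All.lookup s∉ss s'∈ (column-injective (trans (sym (firstColumn-map g∈ₗ)) eq))

  length-extensions : ∀ {ℓ} ss → (∀ s → length (L s) ≡ ℓ) →
                      length (extensions L ss) ≡ length ss * ℓ
  length-extensions [] _ = refl
  length-extensions {ℓ} (s ∷ ss) len = begin
    length (map (column s ◂_) (L s) ++ extensions L ss)  ≡⟨ length-++ (map (column s ◂_) (L s)) ⟩
    length (map (column s ◂_) (L s)) + length (extensions L ss)
      ≡⟨ cong₂ _+_ (trans (length-map (column s ◂_) (L s)) (len s)) (length-extensions ss len) ⟩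
    ℓ + length ss * ℓ  ∎
    where open ≡-Reasoning

blank∉extensions : ∀ {n} (L : Shade → List (Grid n)) ss {g} →
                   g ∈ extensions L ss → firstColumn g ≢ blank
blank∉extensions L ss g∈ eq =
  let s , _ , eq' = firstColumn-extensions L ss g∈ in column≢blank s (trans (sym eq') eq)

-- tails n s lists the grids g of width n for which column s ◂ g is a Nurikabe grid.
tails : (n : ℕ) → Shade → List (Grid n)
tails zero s = blankGrid 0 ∷ []
tails (suc n) s = blankGrid (suc n) ∷ extensions (tails n) (successors s)

tails-sound : ∀ n s → All (λ g → Nurikabe (column s ◂ g)) (tails n s)
tails-sound zero s = Nurikabe-◂blankGrid (column s) ∷ []
tails-sound (suc n) s =
  Nurikabe-◂blankGrid (column s) ∷ All-extensions⁺ (tails n) (successors s) λ {s'} s'∈ →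
    All.map (λ {g} → successor-sound {g = g} s'∈) (tails-sound n s')

tails-complete : ∀ n s (g : Grid n) → Nurikabe (column s ◂ g) → g ∈ tails n s
tails-complete zero s ([] ∷ [] ∷ []) _ = here refl
tails-complete (suc n) s g nurikabe with firstColumnView g
... | blank◂ g' = here (blank-after-shade {s = s} {g = g'} nurikabe)
... | shaded◂ s' g' =
  there (∈-extensions⁺ (tails n) (successor-complete s s' {g'} nurikabe)
                                  (tails-complete n s' g' (Nurikabe-◂⁻ {c = column s} nurikabe)))

tails-unique : ∀ n s → Unique (tails n s)
tails-unique zero s = [] ∷ []
tails-unique (suc n) s =
  All.tabulate (λ g∈ eq → blank∉extensions (tails n) (successors s) g∈ (cong firstColumn (sym eq)))
  ∷
  extensions-unique (tails n) (successors-unique s) (tails-unique n)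

tailCount : ℕ → ℕ
tailCount zero = 1
tailCount (suc n) = suc (2 * tailCount n)

tailCount-closed : ∀ n → suc (tailCount n) ≡ 2 ^ suc n
tailCount-closed zero = refl
tailCount-closed (suc n) = begin
  suc (suc (2 * tailCount n))  ≡⟨ sym (*-suc 2 (tailCount n)) ⟩
  2 * suc (tailCount n)        ≡⟨ cong (2 *_) (tailCount-closed n) ⟩
  2 * 2 ^ suc n                ∎
  where open ≡-Reasoning

tails-length : ∀ n s → length (tails n s) ≡ tailCount n
tails-length zero s = refl
tails-length (suc n) s =
  cong suc (trans (length-extensions (tails n) (successors s) (tails-length n))
                  (cong (_* tailCount n) (length-successors s)))

shades : List Shade
shades = top ∷ bottom ∷ full ∷ []

shades-complete : ∀ s → s ∈ shades
shades-complete top = here refl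
shades-complete bottom = there (here refl)
shades-complete full = there (there (here refl))

shades-unique : Unique shades
shades-unique = ((λ ()) ∷ (λ ()) ∷ []) ∷ ((λ ()) ∷ []) ∷ [] ∷ []

nurikabes : (n : ℕ) → List (Grid n)
nurikabes zero = blankGrid 0 ∷ []
nurikabes (suc n) = map (blank ◂_) (nurikabes n) ++ extensions (tails n) shades

nurikabes-sound : ∀ n → All Nurikabe (nurikabes n)
nurikabes-sound zero = Nurikabe-blankGrid ∷ []
nurikabes-sound (suc n) =
  All.++⁺ (All.map⁺ (All.map Nurikabe-blank◂ (nurikabes-sound n)))
          (All-extensions⁺ (tails n) shades λ {s} _ → tails-sound n s)

nurikabes-complete : ∀ n (g : Grid n) → Nurikabe g → g ∈ nurikabes n
nurikabes-complete zero ([] ∷ [] ∷ []) _ = here refl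
nurikabes-complete (suc n) g nurikabe with firstColumnView g
... | blank◂ g' = ∈-++⁺ˡ (∈-map⁺ (blank ◂_) (nurikabes-complete n g' (Nurikabe-◂⁻ nurikabe)))
... | shaded◂ s g' = ∈-++⁺ʳ (map (blank ◂_) (nurikabes n))
                       (∈-extensions⁺ (tails n) (shades-complete s) (tails-complete n s g' nurikabe))

nurikabes-unique : ∀ n → Unique (nurikabes n)
nurikabes-unique zero = [] ∷ []
nurikabes-unique (suc n) =
  Unique.++⁺ (Unique.map⁺ ◂-injective (nurikabes-unique n))
             (extensions-unique (tails n) shades-unique (tails-unique n))
             (λ (g∈ₗ , g∈ᵣ) → blank∉extensions (tails n) shades g∈ᵣ (firstColumn-map g∈ₗ))

nurikabes-length : ∀ n → (length (nurikabes n) + 5) + 3 * n ≡ 6 * 2 ^ n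
nurikabes-length zero = refl
nurikabes-length (suc n) = begin
  (length (map (blank ◂_) N ++ extensions (tails n) shades) + 5) + 3 * suc n
    ≡⟨ cong (λ ℓ → (ℓ + 5) + 3 * suc n) length-suc ⟩
  ((length N + 3 * tailCount n) + 5) + 3 * suc n
    ≡⟨ regroup (length N) n (tailCount n) ⟩
  ((length N + 5) + 3 * n) + 3 * suc (tailCount n)
    ≡⟨ cong₂ (λ x y → x + 3 * y) (nurikabes-length n) (tailCount-closed n) ⟩
  6 * 2 ^ n + 3 * (2 * 2 ^ n)
    ≡⟨ double (2 ^ n) ⟩
  6 * (2 * 2 ^ n)  ∎
  where
  open ≡-Reasoning
  N : List (Grid n)
  N = nurikabes n
  length-suc : length (map (blank ◂_) N ++ extensions (tails n) shades) ≡ length N + 3 * tailCount n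
  length-suc = trans (length-++ (map (blank ◂_) N))
    (cong₂ _+_ (length-map (blank ◂_) N) (length-extensions (tails n) shades (tails-length n)))
  regroup : ∀ ℓ m t → ((ℓ + 3 * t) + 5) + 3 * suc m ≡ ((ℓ + 5) + 3 * m) + 3 * suc t
  regroup = solve-∀
  double : ∀ x → 6 * x + 3 * (2 * x) ≡ 6 * (2 * x)
  double = solve-∀

theorem11p2 : (n : ℕ) →
    Σ (List (Grid n)) (λ L →
      Unique L × All Nurikabe L × (∀ (g : Grid n) → Nurikabe g → g ∈ L) ×
      length L ≡ 6 * 2 ^ n ∸ 3 * n ∸ 5)
theorem11p2 n =
  nurikabes n , nurikabes-unique n , nurikabes-sound n , nurikabes-complete n , count
  where
  count : length (nurikabes n) ≡ 6 * 2 ^ n ∸ 3 * n ∸ 5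
  count rewrite sym (nurikabes-length n)
    | m+n∸n≡m (length (nurikabes n) + 5) (3 * n) = sym (m+n∸n≡m (length (nurikabes n)) 5)
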